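{- For every integer $r\geq 1$, if $G$ is a connected $(P_4\cup rK_1)$-free graph, then $\rho^o(G)\leq 2r+1$.
   Context: All graphs are finite, simple and undirected. For $x\in V(G)$, $N(x)$ is the set of neighbours of $x$. A vertex subset $S$ of $G$ is an open packing if $N(x)\cap N(y)=\emptyset$ for every pair of distinct $x,y\in S$; $\rho^o(G)$ is the maximum size of an open packing. A graph is $H$-free if it has no induced subgraph isomorphic to $H$. $P_4$ is the path on four vertices, $rK_1$ the edgeless graph on $r$ vertices, and $\cup$ denotes disjoint union. -}

module Defs where

open import Data.Nat using (ℕ; zero; suc; _+_; _≤_)
open import Data.Bool using (Bool; true; false; _∨_)
open import Data.Fin using (Fin; toℕ)
open import Data.Fin.Subset using (Subset; _∈_; ∣_∣)
open import Data.Product using (Σ; _×_)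
open import Data.Empty using (⊥)
open import Relation.Nullary using (¬_)
open import Relation.Binary.PropositionalEquality using (_≡_; _≢_)
open import Function.Definitions using (Injective)

record Graph : Set where
  field
    n      : ℕ
    adj    : Fin n → Fin n → Bool
    sym    : ∀ x y → adj x y ≡ adj y x
    irrefl : ∀ x → adj x x ≡ false

open Graph public

Adj : (G : Graph) → Fin (n G) → Fin (n G) → Set
Adj G x y = adj G x y ≡ true

data Walk (G : Graph) : Fin (n G) → Fin (n G) → Set where
  here : ∀ {x} → Walk G x x
  step : ∀ {x y z} → Adj G x y → Walk G y z → Walk G x z

Connected : Graph → Set
Connected G = ∀ x y → Walk G x y

IsOpenPacking : (G : Graph) → Subset (n G) → Set
IsOpenPacking G S =
  ∀ x y → x ∈ S → y ∈ S → x ≢ y → ∀ z → ¬ (Adj G z x × Adj G z y)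

OpenPackingNumber≤ : Graph → ℕ → Set
OpenPackingNumber≤ G k = ∀ S → IsOpenPacking G S → ∣ S ∣ ≤ k

p4adj : ℕ → ℕ → Bool
p4adj 0 1 = true
p4adj 1 0 = true
p4adj 1 2 = true
p4adj 2 1 = true
p4adj 2 3 = true
p4adj 3 2 = true
p4adj _ _ = false

-- P4 ∪ rK1 on vertex set Fin (4 + r): vertices 0..3 form the path,
-- vertices 4..3+r are isolated.
P4∪rK1 : ℕ → Graph
P4∪rK1 r = record
  { n = 4 + r
  ; adj = λ i j → p4adj (toℕ i) (toℕ j)
  ; sym = λ i j → symP (toℕ i) (toℕ j)
  ; irrefl = λ i → irrP (toℕ i)
  }
  where
  symP : ∀ a b → p4adj a b ≡ p4adj b a
  symP 0 0 = _≡_.refl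
  symP 0 1 = _≡_.refl
  symP 0 2 = _≡_.refl
  symP 0 3 = _≡_.refl
  symP 0 (suc (suc (suc (suc _)))) = _≡_.refl
  symP 1 0 = _≡_.refl
  symP 1 1 = _≡_.refl
  symP 1 2 = _≡_.refl
  symP 1 3 = _≡_.refl
  symP 1 (suc (suc (suc (suc _)))) = _≡_.refl
  symP 2 0 = _≡_.refl
  symP 2 1 = _≡_.refl
  symP 2 2 = _≡_.refl
  symP 2 3 = _≡_.refl
  symP 2 (suc (suc (suc (suc _)))) = _≡_.refl
  symP 3 0 = _≡_.refl
  symP 3 1 = _≡_.refl
  symP 3 2 = _≡_.refl
  symP 3 3 = _≡_.refl
  symP 3 (suc (suc (suc (suc _)))) = _≡_.refl
  symP (suc (suc (suc (suc _)))) 0 = _≡_.refl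
  symP (suc (suc (suc (suc _)))) 1 = _≡_.refl
  symP (suc (suc (suc (suc _)))) 2 = _≡_.refl
  symP (suc (suc (suc (suc _)))) 3 = _≡_.refl
  symP (suc (suc (suc (suc _)))) (suc (suc (suc (suc _)))) = _≡_.refl
  irrP : ∀ a → p4adj a a ≡ false
  irrP 0 = _≡_.refl
  irrP 1 = _≡_.refl
  irrP 2 = _≡_.refl
  irrP 3 = _≡_.refl
  irrP (suc (suc (suc (suc _)))) = _≡_.refl

InducedSubgraph : Graph → Graph → Set
InducedSubgraph H G =
  Σ (Fin (n H) → Fin (n G)) λ f →
    Injective _≡_ _≡_ f × (∀ i j → adj G (f i) (f j) ≡ adj H i j)

Free : Graph → Graph → Set
Free H G = ¬ InducedSubgraph H G

-- Suppose S is an open packing with |S| ≥ 2r + 2. Every vertex has at most one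
-- neighbour in S, so G[S] is a matching and any m vertices of S contain ⌈m/2⌉
-- pairwise distinct, non-adjacent ones. Pick such x, b ∈ S and let B = N[x] ∩ S.
-- Shortening a walk from B to b gives an induced path u₀u₁u₂u₃ with u₀ ∈ B and u₂, u₃
-- neither in nor adjacent to B. If u₀ has no neighbour in S, u₀u₁u₂u₃ is an induced
-- P4 and only u₀ and the S-neighbours of u₂, u₃ can touch it; if ū ∈ S is adjacent to
-- u₀, then ū ∈ B, ū u₀ u₁ u₂ is an induced P4 and only u₀, ū and the S-neighbour of u₂
-- can touch it. Either way at least 2r − 1 vertices of S are far from the P4, and r of
-- them are independent, so G contains an induced P4 ∪ rK1.

module Submission where

open import Defs hiding (sym)
open import Data.Nat using (ℕ; zero; suc; _+_; _*_; _≤_; _<_; s≤s; z≤n; s≤s⁻¹)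
open import Data.Nat.Properties
  using (≤-refl; ≤-reflexive; ≤-trans; <-trans; n<1+n; m≤n⇒m≤1+n; +-comm; +-suc; *-suc;
         +-monoʳ-≤; +-monoˡ-≤; *-monoʳ-≤; <⇒≤; +-cancelʳ-≤; n≮0; _≤?_; ≰⇒>;
         module ≤-Reasoning)
open import Data.Nat.Induction using (<-wellFounded)
open import Data.Bool using (true; false)
import Data.Bool as Bool
open import Data.Fin using (Fin; zero; suc; _≟_)
open import Data.Fin.Patterns using (0F; 1F; 2F; 3F)
open import Data.Fin.Properties using (any?; suc-injective; 0≢1+n)
open import Data.Fin.Subset using (Subset; _∈_; _∉_; ∣_∣; Nonempty; ⊥; _∩_; ∁; ⁅_⁆;
                                  inside; outside)
open import Data.Fin.Subset.Properties
  using (_∈?_; nonempty?; Empty-unique; ∣⊥∣≡0; ∣⁅x⁆∣≡1; ∣p∩q∣≤∣q∣; x∈p∩q⁺; x∈p∩q⁻;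
         x∈∁p⇒x∉p; x∈⁅x⁆)
open import Data.Vec.Base using ([]; _∷_; tabulate; here; there)
open import Data.Vec.Properties using (lookup∘tabulate; []=⇒lookup; lookup⇒[]=)
open import Data.Product using (Σ; _×_; _,_; proj₁; proj₂; map₂; ∃-syntax)
open import Data.Sum using (_⊎_; inj₁; inj₂)
open import Data.Empty using (⊥-elim)
open import Induction.WellFounded using (Acc; acc)
open import Relation.Nullary using (¬_; Dec; yes; no; contradiction)
open import Relation.Nullary.Decidable using (_×-dec_; _⊎-dec_)
open import Relation.Unary using (Decidable)
open import Relation.Binary.PropositionalEquality
  using (_≡_; _≢_; refl; sym; trans; cong; subst)

∣p∣≡∣p∩∁q∣+∣p∩q∣ : ∀ {n} (p q : Subset n) → ∣ p ∣ ≡ ∣ p ∩ ∁ q ∣ + ∣ p ∩ q ∣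
∣p∣≡∣p∩∁q∣+∣p∩q∣ []            []            = refl
∣p∣≡∣p∩∁q∣+∣p∩q∣ (outside ∷ p) (_       ∷ q) = ∣p∣≡∣p∩∁q∣+∣p∩q∣ p q
∣p∣≡∣p∩∁q∣+∣p∩q∣ (inside  ∷ p) (outside ∷ q) = cong suc (∣p∣≡∣p∩∁q∣+∣p∩q∣ p q)
∣p∣≡∣p∩∁q∣+∣p∩q∣ (inside  ∷ p) (inside  ∷ q) =
  trans (cong suc (∣p∣≡∣p∩∁q∣+∣p∩q∣ p q)) (sym (+-suc _ _))

∣p∣≤1+∣p∩∁q∣ : ∀ {n} (p q : Subset n) → ∣ p ∩ q ∣ ≤ 1 → ∣ p ∣ ≤ suc ∣ p ∩ ∁ q ∣
∣p∣≤1+∣p∩∁q∣ p q ∣p∩q∣≤1 = begin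
  ∣ p ∣                     ≡⟨ ∣p∣≡∣p∩∁q∣+∣p∩q∣ p q ⟩
  ∣ p ∩ ∁ q ∣ + ∣ p ∩ q ∣   ≤⟨ +-monoʳ-≤ ∣ p ∩ ∁ q ∣ ∣p∩q∣≤1 ⟩
  ∣ p ∩ ∁ q ∣ + 1           ≡⟨ +-comm ∣ p ∩ ∁ q ∣ 1 ⟩
  suc ∣ p ∩ ∁ q ∣           ∎
  where open ≤-Reasoning

∣p∣≤1+∣p∩∁⁅x⁆∣ : ∀ {n} (p : Subset n) x → ∣ p ∣ ≤ suc ∣ p ∩ ∁ ⁅ x ⁆ ∣
∣p∣≤1+∣p∩∁⁅x⁆∣ p x = ∣p∣≤1+∣p∩∁q∣ p ⁅ x ⁆ (≤-trans (∣p∩q∣≤∣q∣ p ⁅ x ⁆) (≤-reflexive (∣⁅x⁆∣≡1 x)))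

unique⇒∣p∣≤1 : ∀ {n} {p : Subset n} → (∀ {x y} → x ∈ p → y ∈ p → x ≡ y) → ∣ p ∣ ≤ 1
unique⇒∣p∣≤1 {p = []}          _      = z≤n
unique⇒∣p∣≤1 {p = outside ∷ p} unique =
  unique⇒∣p∣≤1 λ x∈p y∈p → suc-injective (unique (there x∈p) (there y∈p))
unique⇒∣p∣≤1 {suc n} {inside ∷ p} unique = s≤s (≤-reflexive (trans (cong ∣_∣ p≡⊥) (∣⊥∣≡0 n)))
  where
  p≡⊥ : p ≡ ⊥
  p≡⊥ = Empty-unique λ (y , y∈p) → 0≢1+n (unique here (there y∈p))

0<∣p∣⇒Nonempty : ∀ {n} {p : Subset n} → 0 < ∣ p ∣ → Nonempty p
0<∣p∣⇒Nonempty {n} {p} 0<∣p∣ with nonempty? p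
... | yes ne = ne
... | no ¬ne = ⊥-elim (n≮0 (subst (0 <_) ∣p∣≡0 0<∣p∣))
  where
  ∣p∣≡0 : ∣ p ∣ ≡ 0
  ∣p∣≡0 = trans (cong ∣_∣ (Empty-unique ¬ne)) (∣⊥∣≡0 n)

x∈p∩∁q⁻ : ∀ {n} {x : Fin n} (p q : Subset n) → x ∈ p ∩ ∁ q → x ∈ p × x ∉ q
x∈p∩∁q⁻ p q x∈ = map₂ x∈∁p⇒x∉p (x∈p∩q⁻ p (∁ q) x∈)

adj≡false⇒¬Adj : ∀ G {u v} → adj G u v ≡ false → ¬ Adj G u v
adj≡false⇒¬Adj _ uv≡false uv with () ← trans (sym uv≡false) uv

module _ (G : Graph) where

  private
    V : Set
    V = Fin (n G)

  Adj-sym : ∀ {u v} → Adj G u v → Adj G v u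
  Adj-sym {u} {v} uv = trans (Graph.sym G v u) uv

  Adj⇒≢ : ∀ {u v} → Adj G u v → u ≢ v
  Adj⇒≢ {u} uv refl with () ← trans (sym (irrefl G u)) uv

  Adj? : ∀ u v → Dec (Adj G u v)
  Adj? u v = adj G u v Bool.≟ true

  ¬Adj⇒adj≡false : ∀ {u v} → ¬ Adj G u v → adj G u v ≡ false
  ¬Adj⇒adj≡false {u} {v} ¬uv with adj G u v
  ... | true  = contradiction refl ¬uv
  ... | false = refl

  Apart : V → V → Set
  Apart u v = u ≢ v × ¬ Adj G u v

  Apart-sym : ∀ {u v} → Apart u v → Apart v u
  Apart-sym (u≢v , ¬uv) = (λ v≡u → u≢v (sym v≡u)) , λ vu → ¬uv (Adj-sym vu)

  Independent : ∀ {r} → (Fin r → V) → Set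
  Independent t = ∀ i j → i ≢ j → Apart (t i) (t j)

  neighbours : V → Subset (n G)
  neighbours u = tabulate (adj G u)

  ∈-neighbours⁻ : ∀ {u v} → v ∈ neighbours u → Adj G u v
  ∈-neighbours⁻ {u} {v} v∈ = trans (sym (lookup∘tabulate (adj G u) v)) ([]=⇒lookup v∈)

  ∈-neighbours⁺ : ∀ {u v} → Adj G u v → v ∈ neighbours u
  ∈-neighbours⁺ {u} {v} uv = lookup⇒[]= v (neighbours u) (trans (lookup∘tabulate (adj G u) v) uv)

  AtMostOneNeighbourIn : Subset (n G) → Set
  AtMostOneNeighbourIn T = ∀ {u v w} → v ∈ T → w ∈ T → Adj G u v → Adj G u w → v ≡ w

  openPacking⇒atMostOneNeighbourIn : ∀ {S} → IsOpenPacking G S → AtMostOneNeighbourIn S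
  openPacking⇒atMostOneNeighbourIn packing {u} {v} {w} v∈S w∈S uv uw with v ≟ w
  ... | yes v≡w = v≡w
  ... | no  v≢w = ⊥-elim (packing v w v∈S w∈S v≢w u (uv , uw))

  atMostOneNeighbourIn-∩ : ∀ {p} q → AtMostOneNeighbourIn p → AtMostOneNeighbourIn (p ∩ q)
  atMostOneNeighbourIn-∩ {p} q atMostOne v∈ w∈ = atMostOne (proj₁ (x∈p∩q⁻ p q v∈)) (proj₁ (x∈p∩q⁻ p q w∈))

  ∣T∣≤1+∣T∩∁N∣ : ∀ {T} → AtMostOneNeighbourIn T → ∀ u → ∣ T ∣ ≤ suc ∣ T ∩ ∁ (neighbours u) ∣
  ∣T∣≤1+∣T∩∁N∣ {T} atMostOne u = ∣p∣≤1+∣p∩∁q∣ T (neighbours u) (unique⇒∣p∣≤1 unique)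
    where
    unique : ∀ {v w} → v ∈ T ∩ neighbours u → w ∈ T ∩ neighbours u → v ≡ w
    unique v∈ w∈ with x∈p∩q⁻ T _ v∈ | x∈p∩q⁻ T _ w∈
    ... | v∈T , v∈N | w∈T , w∈N = atMostOne v∈T w∈T (∈-neighbours⁻ v∈N) (∈-neighbours⁻ w∈N)

  -- Greedily keep a vertex x of T and discard x together with its at most one neighbour in T.
  independentIn : ∀ {T} → AtMostOneNeighbourIn T → ∀ r → 2 * r ≤ suc ∣ T ∣ →
    Σ (Fin r → V) λ t → (∀ j → t j ∈ T) × Independent t
  independentIn atMostOne zero _ = (λ ()) , (λ ()) , λ ()
  independentIn {T} atMostOne (suc r) 2[1+r]≤1+∣T∣ = t , t∈T , t-independent
    where
    bound : 2 + 2 * r ≤ suc ∣ T ∣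
    bound = subst (_≤ suc ∣ T ∣) (*-suc 2 r) 2[1+r]≤1+∣T∣

    nonempty : Nonempty T
    nonempty = 0<∣p∣⇒Nonempty (≤-trans (s≤s z≤n) (s≤s⁻¹ bound))

    x : V
    x = proj₁ nonempty

    T₁ T₂ : Subset (n G)
    T₁ = T ∩ ∁ ⁅ x ⁆
    T₂ = T₁ ∩ ∁ (neighbours x)

    ∣T∣≤2+∣T₂∣ : ∣ T ∣ ≤ 2 + ∣ T₂ ∣
    ∣T∣≤2+∣T₂∣ = ≤-trans (∣p∣≤1+∣p∩∁⁅x⁆∣ T x)
                         (s≤s (∣T∣≤1+∣T∩∁N∣ (atMostOneNeighbourIn-∩ _ atMostOne) x))

    rest : Σ (Fin r → V) λ t′ → (∀ j → t′ j ∈ T₂) × Independent t′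
    rest = independentIn (atMostOneNeighbourIn-∩ _ (atMostOneNeighbourIn-∩ _ atMostOne)) r
                         (s≤s⁻¹ (s≤s⁻¹ (≤-trans bound (s≤s ∣T∣≤2+∣T₂∣))))

    ∈T₂⁻ : ∀ {v} → v ∈ T₂ → v ∈ T × Apart x v
    ∈T₂⁻ v∈T₂ with x∈p∩∁q⁻ T₁ _ v∈T₂
    ... | v∈T₁ , v∉N with x∈p∩∁q⁻ T _ v∈T₁
    ... | v∈T , v∉⁅x⁆ =
      v∈T , (λ { refl → v∉⁅x⁆ (x∈⁅x⁆ x) }) , λ xv → v∉N (∈-neighbours⁺ xv)

    t : Fin (suc r) → V
    t zero    = x
    t (suc j) = proj₁ rest j

    t∈T : ∀ j → t j ∈ T
    t∈T zero    = proj₂ nonempty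
    t∈T (suc j) = proj₁ (∈T₂⁻ (proj₁ (proj₂ rest) j))

    t-independent : Independent t
    t-independent zero    zero    0≢0 = contradiction refl 0≢0
    t-independent zero    (suc l) _   = proj₂ (∈T₂⁻ (proj₁ (proj₂ rest) l))
    t-independent (suc j) zero    _   = Apart-sym (proj₂ (∈T₂⁻ (proj₁ (proj₂ rest) j)))
    t-independent (suc j) (suc l) j≢l = proj₂ (proj₂ rest) j l (λ j≡l → j≢l (cong suc j≡l))

  Near : (V → Set) → V → Set
  Near B v = ∃[ u ] (B u × (u ≡ v ⊎ Adj G u v))

  Near? : ∀ {B} → Decidable B → Decidable (Near B)
  Near? B? v = any? λ u → B? u ×-dec ((u ≟ v) ⊎-dec Adj? u v)

  ¬Near⇒Apart : ∀ {B u v} → B u → ¬ Near B v → Apart u v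
  ¬Near⇒Apart {u = u} u∈B far = (λ u≡v → far (u , u∈B , inj₁ u≡v)) , λ uv → far (u , u∈B , inj₂ uv)

  Distant : V → V → Set
  Distant u v = Apart u v × (∀ z → ¬ (Adj G z u × Adj G z v))

  record ExitPath (B : V → Set) : Set where
    field
      u₀ u₁ u₂ u₃ : V
      u₀∈B : B u₀
      u₀u₁  : Adj G u₀ u₁
      u₁u₂  : Adj G u₁ u₂
      u₂u₃  : Adj G u₂ u₃
      u₁∥u₃ : Apart u₁ u₃
      u₂-far : ¬ Near B u₂
      u₃-far : ¬ Near B u₃

  length : ∀ {u v} → Walk G u v → ℕ
  length here       = 0
  length (step _ p) = suc (length p)

  enter : ∀ {u v w} → u ≡ v ⊎ Adj G u v → Walk G v w → Walk G u w
  enter (inj₁ refl) p = p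
  enter (inj₂ uv)   p = step uv p

  length-enter : ∀ {u v w} (uv : u ≡ v ⊎ Adj G u v) (p : Walk G v w) →
    length (enter uv p) ≤ suc (length p)
  length-enter (inj₁ refl) p = m≤n⇒m≤1+n ≤-refl
  length-enter (inj₂ _)    p = ≤-refl

  -- Whenever one of the four defining conditions fails, a strictly shorter walk from B
  -- to b is obtained, so recursion on the length of the walk terminates.
  exitPath : ∀ {B} → Decidable B → ∀ {b} → (∀ {u} → B u → Distant u b) →
    ∀ {u} → B u → Walk G u b → ExitPath B
  exitPath {B} B? {b} distant u∈B p = shorten u∈B p (<-wellFounded (length p))
    where
    shorten : ∀ {u} → B u → (p : Walk G u b) → Acc _<_ (length p) → ExitPath B
    shorten u∈B here _ = contradiction refl (proj₁ (proj₁ (distant u∈B)))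
    shorten u∈B (step ub here) _ = contradiction ub (proj₂ (proj₁ (distant u∈B)))
    shorten u∈B (step uv (step vb here)) _ = ⊥-elim (proj₂ (distant u∈B) _ (Adj-sym uv , vb))
    shorten u∈B (step {y = v₁} uv₁ (step {y = v₂} v₁v₂ (step {y = v₃} v₂v₃ p))) (acc shorter)
      with Near? B? v₂ | Near? B? v₃ | v₁ ≟ v₃ | Adj? v₁ v₃
    ... | yes (u′ , u′∈B , u′v₂) | _ | _ | _ =
      shorten u′∈B (enter u′v₂ (step v₂v₃ p)) (shorter (s≤s (length-enter u′v₂ _)))
    ... | no _ | yes (u′ , u′∈B , u′v₃) | _ | _ =
      shorten u′∈B (enter u′v₃ p) (shorter (s≤s (m≤n⇒m≤1+n (length-enter u′v₃ p))))
    ... | no _ | no _ | yes refl | _ =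
      shorten u∈B (step uv₁ p) (shorter (<-trans (n<1+n _) (n<1+n _)))
    ... | no _ | no _ | no _ | yes v₁v₃ =
      shorten u∈B (step uv₁ (step v₁v₃ p)) (shorter (n<1+n _))
    ... | no v₂-far | no v₃-far | no v₁≢v₃ | no ¬v₁v₃ = record
      { u₀∈B = u∈B ; u₀u₁ = uv₁ ; u₁u₂ = v₁v₂ ; u₂u₃ = v₂v₃
      ; u₁∥u₃ = v₁≢v₃ , ¬v₁v₃ ; u₂-far = v₂-far ; u₃-far = v₃-far }

  inducedSubgraph : ∀ H (f : Fin (n H) → V) →
    (∀ i j → Adj H i j → Adj G (f i) (f j)) →
    (∀ i j → i ≢ j → ¬ Adj H i j → Apart (f i) (f j)) →
    InducedSubgraph H G
  inducedSubgraph H f edge apart = f , (λ {i} {j} → injective i j) , adjacency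
    where
    injective : ∀ i j → f i ≡ f j → i ≡ j
    injective i j fi≡fj with i ≟ j | adj H i j in ij
    ... | yes i≡j | _     = i≡j
    ... | no _    | true  = contradiction fi≡fj (Adj⇒≢ (edge i j ij))
    ... | no i≢j  | false = contradiction fi≡fj (proj₁ (apart i j i≢j (adj≡false⇒¬Adj H ij)))

    adjacency : ∀ i j → adj G (f i) (f j) ≡ adj H i j
    adjacency i j with i ≟ j | adj H i j in ij
    ... | yes refl | _     = trans (irrefl G (f i)) (trans (sym (irrefl H i)) ij)
    ... | no _     | true  = edge i j ij
    ... | no i≢j   | false = ¬Adj⇒adj≡false (proj₂ (apart i j i≢j (adj≡false⇒¬Adj H ij)))

  record InducedP4 : Set where
    field
      a b c d : V
      ab : Adj G a b
      bc : Adj G b c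
      cd : Adj G c d
      a∥c : Apart a c
      a∥d : Apart a d
      b∥d : Apart b d

  ApartFrom : InducedP4 → V → Set
  ApartFrom P v = Apart a v × Apart b v × Apart c v × Apart d v
    where open InducedP4 P

  pattern isolated j = suc (suc (suc (suc j)))

  module _ (P : InducedP4) {r} (t : Fin r → V)
           (t-apart : ∀ j → ApartFrom P (t j)) (t-independent : Independent t) where
    open InducedP4 P

    private
      H : Graph
      H = P4∪rK1 r

    p4∪isolated : Fin (n H) → V
    p4∪isolated 0F           = a
    p4∪isolated 1F           = b
    p4∪isolated 2F           = c
    p4∪isolated 3F           = d
    p4∪isolated (isolated j) = t j

    p4∪isolated-edge : ∀ i j → Adj H i j → Adj G (p4∪isolated i) (p4∪isolated j)
    p4∪isolated-edge 0F 1F _ = ab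
    p4∪isolated-edge 1F 0F _ = Adj-sym ab
    p4∪isolated-edge 1F 2F _ = bc
    p4∪isolated-edge 2F 1F _ = Adj-sym bc
    p4∪isolated-edge 2F 3F _ = cd
    p4∪isolated-edge 3F 2F _ = Adj-sym cd
    p4∪isolated-edge 0F 0F ()
    p4∪isolated-edge 0F (suc (suc _)) ()
    p4∪isolated-edge 1F 1F ()
    p4∪isolated-edge 1F (suc 2F) ()
    p4∪isolated-edge 1F (isolated _) ()
    p4∪isolated-edge 2F 0F ()
    p4∪isolated-edge 2F 2F ()
    p4∪isolated-edge 2F (isolated _) ()
    p4∪isolated-edge 3F 0F ()
    p4∪isolated-edge 3F 1F ()
    p4∪isolated-edge 3F (suc (suc (suc _))) ()
    p4∪isolated-edge (isolated _) _ ()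

    p4∪isolated-apart : ∀ i j → i ≢ j → ¬ Adj H i j →
      Apart (p4∪isolated i) (p4∪isolated j)
    p4∪isolated-apart 0F 2F _ _ = a∥c
    p4∪isolated-apart 0F 3F _ _ = a∥d
    p4∪isolated-apart 1F 3F _ _ = b∥d
    p4∪isolated-apart 2F 0F _ _ = Apart-sym a∥c
    p4∪isolated-apart 3F 0F _ _ = Apart-sym a∥d
    p4∪isolated-apart 3F 1F _ _ = Apart-sym b∥d
    p4∪isolated-apart 0F (isolated j) _ _ = proj₁ (t-apart j)
    p4∪isolated-apart 1F (isolated j) _ _ = proj₁ (proj₂ (t-apart j))
    p4∪isolated-apart 2F (isolated j) _ _ = proj₁ (proj₂ (proj₂ (t-apart j)))
    p4∪isolated-apart 3F (isolated j) _ _ = proj₂ (proj₂ (proj₂ (t-apart j)))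
    p4∪isolated-apart (isolated j) 0F _ _ = Apart-sym (proj₁ (t-apart j))
    p4∪isolated-apart (isolated j) 1F _ _ = Apart-sym (proj₁ (proj₂ (t-apart j)))
    p4∪isolated-apart (isolated j) 2F _ _ = Apart-sym (proj₁ (proj₂ (proj₂ (t-apart j))))
    p4∪isolated-apart (isolated j) 3F _ _ = Apart-sym (proj₂ (proj₂ (proj₂ (t-apart j))))
    p4∪isolated-apart (isolated j) (isolated l) i≢j _ =
      t-independent j l λ j≡l → i≢j (cong isolated j≡l)
    p4∪isolated-apart 0F 0F i≢i _ = contradiction refl i≢i
    p4∪isolated-apart 1F 1F i≢i _ = contradiction refl i≢i
    p4∪isolated-apart 2F 2F i≢i _ = contradiction refl i≢i
    p4∪isolated-apart 3F 3F i≢i _ = contradiction refl i≢i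
    p4∪isolated-apart 0F 1F _ ¬ij = contradiction refl ¬ij
    p4∪isolated-apart 1F 0F _ ¬ij = contradiction refl ¬ij
    p4∪isolated-apart 1F 2F _ ¬ij = contradiction refl ¬ij
    p4∪isolated-apart 2F 1F _ ¬ij = contradiction refl ¬ij
    p4∪isolated-apart 2F 3F _ ¬ij = contradiction refl ¬ij
    p4∪isolated-apart 3F 2F _ ¬ij = contradiction refl ¬ij

    p4∪independent : InducedSubgraph H G
    p4∪independent = inducedSubgraph H p4∪isolated p4∪isolated-edge p4∪isolated-apart

  module _ {S : Subset (n G)} (packing : IsOpenPacking G S) where

    private
      oneNeighbour : AtMostOneNeighbourIn S
      oneNeighbour = openPacking⇒atMostOneNeighbourIn packing

    neighbour-apart : ∀ {u w v} → u ∈ S → Adj G u w → v ∈ S → v ≢ u → ¬ Adj G u v → Apart w v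
    neighbour-apart u∈S uw v∈S v≢u ¬uv =
      (λ { refl → ¬uv uw }) , λ wv → v≢u (oneNeighbour v∈S u∈S wv (Adj-sym uw))

    second-neighbour∉S : ∀ {u w y} → u ∈ S → Adj G u w → Adj G w y → u ≢ y → y ∉ S
    second-neighbour∉S u∈S uw wy u≢y y∈S = u≢y (oneNeighbour u∈S y∈S (Adj-sym uw) wy)

    Avoids : V → V → V → V → Set
    Avoids u y z v = v ∈ S × v ≢ u × ¬ Adj G y v × ¬ Adj G z v

    independentAvoiding : ∀ r → 2 * r + 1 < ∣ S ∣ → ∀ u y z →
      Σ (Fin r → V) λ t → (∀ j → Avoids u y z (t j)) × Independent t
    independentAvoiding r 2r+1<∣S∣ u y z = t , t-avoids , t-independent
      where
      R₁ R₂ R₃ : Subset (n G)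
      R₁ = S ∩ ∁ ⁅ u ⁆
      R₂ = R₁ ∩ ∁ (neighbours y)
      R₃ = R₂ ∩ ∁ (neighbours z)

      oneNeighbour₂ : AtMostOneNeighbourIn R₂
      oneNeighbour₂ = atMostOneNeighbourIn-∩ _ (atMostOneNeighbourIn-∩ _ oneNeighbour)

      ∣S∣≤3+∣R₃∣ : ∣ S ∣ ≤ 3 + ∣ R₃ ∣
      ∣S∣≤3+∣R₃∣ = ≤-trans (∣p∣≤1+∣p∩∁⁅x⁆∣ S u) (s≤s (≤-trans
        (∣T∣≤1+∣T∩∁N∣ (atMostOneNeighbourIn-∩ _ oneNeighbour) y)
        (s≤s (∣T∣≤1+∣T∩∁N∣ oneNeighbour₂ z))))

      2r+1≤1+∣R₃∣+1 : 2 * r + 1 ≤ suc ∣ R₃ ∣ + 1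
      2r+1≤1+∣R₃∣+1 = subst (2 * r + 1 ≤_) (+-comm 1 (suc ∣ R₃ ∣))
                            (s≤s⁻¹ (≤-trans 2r+1<∣S∣ ∣S∣≤3+∣R₃∣))

      chosen : Σ (Fin r → V) λ t′ → (∀ j → t′ j ∈ R₃) × Independent t′
      chosen = independentIn (atMostOneNeighbourIn-∩ _ oneNeighbour₂) r
                             (+-cancelʳ-≤ 1 (2 * r) (suc ∣ R₃ ∣) 2r+1≤1+∣R₃∣+1)

      t : Fin r → V
      t = proj₁ chosen

      t-independent : Independent t
      t-independent = proj₂ (proj₂ chosen)

      t-avoids : ∀ j → Avoids u y z (t j)
      t-avoids j = avoids (proj₁ (proj₂ chosen) j)
        where
        avoids : ∀ {v} → v ∈ R₃ → Avoids u y z v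
        avoids v∈R₃ with x∈p∩∁q⁻ R₂ _ v∈R₃
        ... | v∈R₂ , v∉Nz with x∈p∩∁q⁻ R₁ _ v∈R₂
        ... | v∈R₁ , v∉Ny with x∈p∩∁q⁻ S _ v∈R₁
        ... | v∈S , v∉⁅u⁆ =
          v∈S , (λ { refl → v∉⁅u⁆ (x∈⁅x⁆ u) }) ,
          (λ yv → v∉Ny (∈-neighbours⁺ yv)) , λ zv → v∉Nz (∈-neighbours⁺ zv)

    Block : V → V → Set
    Block x u = u ∈ S × (u ≡ x ⊎ Adj G x u)

    Block? : ∀ x → Decidable (Block x)
    Block? x u = (u ∈? S) ×-dec ((u ≟ x) ⊎-dec Adj? x u)

    block-closed : ∀ {x u v} → x ∈ S → Block x u → v ∈ S → Adj G u v → Block x v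
    block-closed _   (_ , inj₁ refl) v∈S xv = v∈S , inj₂ xv
    block-closed x∈S (_ , inj₂ xu)   v∈S uv = v∈S , inj₁ (oneNeighbour v∈S x∈S uv (Adj-sym xu))

    block-distant : ∀ {x b u} → x ∈ S → b ∈ S → Apart x b → Block x u → Distant u b
    block-distant {x} {b} x∈S b∈S x∥b u∈B =
      u∥b u∈B , λ z (zu , zb) → proj₁ (u∥b u∈B) (oneNeighbour (proj₁ u∈B) b∈S zu zb)
      where
      u∥b : ∀ {u} → Block x u → Apart u b
      u∥b (_ , inj₁ refl) = x∥b
      u∥b (_ , inj₂ xu)   = (λ { refl → proj₂ x∥b xu }) ,
                            λ ub → proj₁ x∥b (oneNeighbour x∈S b∈S (Adj-sym xu) ub)

    module _ {x} (x∈S : x ∈ S) (exit : ExitPath (Block x)) {r} (2r+1<∣S∣ : 2 * r + 1 < ∣ S ∣) where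
      open ExitPath exit

      private
        u₀∈S : u₀ ∈ S
        u₀∈S = proj₁ u₀∈B

        u₂∥ : ∀ {v} → v ∈ S → ¬ Adj G u₂ v → Apart u₂ v
        u₂∥ v∈S ¬u₂v =
          (λ u₂≡v → second-neighbour∉S u₀∈S u₀u₁ u₁u₂ (proj₁ (¬Near⇒Apart u₀∈B u₂-far))
                                       (subst (_∈ S) (sym u₂≡v) v∈S)) ,
          ¬u₂v

      isolatedStart⇒P4∪rK1 : (∀ {v} → v ∈ S → ¬ Adj G u₀ v) → InducedSubgraph (P4∪rK1 r) G
      isolatedStart⇒P4∪rK1 no-neighbour
        with t , t-avoids , t-independent ← independentAvoiding r 2r+1<∣S∣ u₀ u₂ u₃ =
        p4∪independent P t (λ j → apartFrom (t-avoids j)) t-independent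
        where
        P : InducedP4
        P = record { a = u₀ ; b = u₁ ; c = u₂ ; d = u₃ ; ab = u₀u₁ ; bc = u₁u₂ ; cd = u₂u₃
                   ; a∥c = ¬Near⇒Apart u₀∈B u₂-far ; a∥d = ¬Near⇒Apart u₀∈B u₃-far ; b∥d = u₁∥u₃ }

        apartFrom : ∀ {v} → Avoids u₀ u₂ u₃ v → ApartFrom P v
        apartFrom (v∈S , v≢u₀ , ¬u₂v , ¬u₃v) =
          ((λ u₀≡v → v≢u₀ (sym u₀≡v)) , no-neighbour v∈S) ,
          neighbour-apart u₀∈S u₀u₁ v∈S v≢u₀ (no-neighbour v∈S) ,
          u₂∥ v∈S ¬u₂v ,
          (λ u₃≡v → ¬u₂v (subst (Adj G u₂) u₃≡v u₂u₃)) , ¬u₃v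

      pairedStart⇒P4∪rK1 : ∀ {ū} → ū ∈ S → Adj G u₀ ū → InducedSubgraph (P4∪rK1 r) G
      pairedStart⇒P4∪rK1 {ū} ū∈S u₀ū
        with t , t-avoids , t-independent ← independentAvoiding r 2r+1<∣S∣ u₀ u₀ u₂ =
        p4∪independent P t (λ j → apartFrom (t-avoids j)) t-independent
        where
        ū∈B : Block x ū
        ū∈B = block-closed x∈S u₀∈B ū∈S u₀ū

        ū∥u₁ : Apart ū u₁
        ū∥u₁ = (λ { refl → u₂-far (ū , ū∈B , inj₂ u₁u₂) }) ,
               λ ūu₁ → Adj⇒≢ u₀ū (oneNeighbour u₀∈S ū∈S (Adj-sym u₀u₁) (Adj-sym ūu₁))

        P : InducedP4
        P = record { a = ū ; b = u₀ ; c = u₁ ; d = u₂ ; ab = Adj-sym u₀ū ; bc = u₀u₁ ; cd = u₁u₂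
                   ; a∥c = ū∥u₁ ; a∥d = ¬Near⇒Apart ū∈B u₂-far ; b∥d = ¬Near⇒Apart u₀∈B u₂-far }

        apartFrom : ∀ {v} → Avoids u₀ u₀ u₂ v → ApartFrom P v
        apartFrom (v∈S , v≢u₀ , ¬u₀v , ¬u₂v) =
          ((λ ū≡v → ¬u₀v (subst (Adj G u₀) ū≡v u₀ū)) ,
           λ ūv → v≢u₀ (oneNeighbour v∈S u₀∈S ūv (Adj-sym u₀ū))) ,
          ((λ u₀≡v → v≢u₀ (sym u₀≡v)) , ¬u₀v) ,
          neighbour-apart u₀∈S u₀u₁ v∈S v≢u₀ ¬u₀v ,
          u₂∥ v∈S ¬u₂v

      exitPath⇒P4∪rK1 : InducedSubgraph (P4∪rK1 r) G
      exitPath⇒P4∪rK1 with nonempty? (S ∩ neighbours u₀)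
      ... | no ¬ne = isolatedStart⇒P4∪rK1 λ v∈S u₀v → ¬ne (_ , x∈p∩q⁺ (v∈S , ∈-neighbours⁺ u₀v))
      ... | yes (_ , ū∈S∩N) with x∈p∩q⁻ S _ ū∈S∩N
      ...   | ū∈S , ū∈N = pairedStart⇒P4∪rK1 ū∈S (∈-neighbours⁻ ū∈N)

    apartPair : 3 ≤ ∣ S ∣ → ∃[ x ] ∃[ b ] (x ∈ S × b ∈ S × Apart x b)
    apartPair 3≤∣S∣ with t , t∈S , t-independent ← independentIn oneNeighbour 2 (s≤s 3≤∣S∣) =
      t 0F , t 1F , t∈S 0F , t∈S 1F , t-independent 0F 1F λ ()

    largePacking⇒P4∪rK1 : Connected G → ∀ r → 1 ≤ r → 2 * r + 1 < ∣ S ∣ →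
      InducedSubgraph (P4∪rK1 r) G
    largePacking⇒P4∪rK1 connected r 1≤r 2r+1<∣S∣
      with x , b , x∈S , b∈S , x∥b ←
             apartPair (≤-trans (+-monoˡ-≤ 1 (*-monoʳ-≤ 2 1≤r)) (<⇒≤ 2r+1<∣S∣)) =
      exitPath⇒P4∪rK1 x∈S exit 2r+1<∣S∣
      where
      exit : ExitPath (Block x)
      exit = exitPath (Block? x) (block-distant x∈S b∈S x∥b) (x∈S , inj₁ refl) (connected x b)

lemma8 : (r : ℕ) → 1 ≤ r → (G : Graph) → Connected G → Free (P4∪rK1 r) G →
    OpenPackingNumber≤ G (2 * r + 1)
lemma8 r 1≤r G connected free S packing with ∣ S ∣ ≤? 2 * r + 1
... | yes ∣S∣≤2r+1 = ∣S∣≤2r+1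
... | no  ∣S∣≰2r+1 = ⊥-elim (free (largePacking⇒P4∪rK1 G packing connected r 1≤r (≰⇒> ∣S∣≰2r+1)))
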